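{- A graph $G$ is strongly $T_3$-reconstructible if and only if (1) every edge of $G$ is necessary, and (2) no additional edge can be added to $G$ without changing $T_3(G)$ (i.e. $T_3(G + xy) \neq T_3(G)$ for every pair of distinct non-adjacent vertices $x, y$). Moreover, condition (2) holds if and only if $N(v_1) \neq N(v_2)$ for any two distinct non-adjacent vertices $v_1, v_2 \in V(G)$.
   Context: Graphs are finite, simple, connected and labeled; two labeled graphs are identical iff they have the same vertex set and edge set. $N(v)$ is the set of neighbors of $v$. $T_3(G)$ is the set of 3-element subsets of $V(G)$ inducing a connected subgraph of $G$. $G$ is strongly $T_3$-reconstructible if every finite, simple, connected labeled graph $H$ with $T_3(H) = T_3(G)$ is identical to $G$. An edge $uv \in E(G)$ is necessary if there is no graph $H$ with $uv \notin E(H)$ and $T_3(H) = T_3(G)$. -}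

module Defs where

open import Data.Nat using (ℕ)
open import Data.Fin using (Fin; _≟_)
open import Data.Fin.Subset using (Subset; _∈_; ∣_∣)
open import Data.Bool using (Bool; true; false; _∨_; _∧_)
open import Data.Product using (Σ; _×_; ∃)
open import Data.Unit using (⊤)
open import Relation.Nullary using (¬_; does)
open import Relation.Binary.PropositionalEquality using (_≡_; _≢_)
open import Function.Bundles using (_⇔_)

-- A labeled graph on the fixed vertex set Fin n, given by its adjacency relation
-- (edge set = { {u,v} | adj u v ≡ true }).
Graph : ℕ → Set
Graph n = Fin n → Fin n → Bool

Edge : ∀ {n} → Graph n → Fin n → Fin n → Set
Edge G u v = G u v ≡ true

IsSimple : ∀ {n} → Graph n → Set
IsSimple {n} G = (∀ u v → G u v ≡ G v u) × (∀ u → G u u ≡ false)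

data Reach {n} (G : Graph n) (P : Fin n → Set) : Fin n → Fin n → Set where
  here : ∀ {u} → Reach G P u u
  step : ∀ {u w v} → Edge G u w → P w → Reach G P w v → Reach G P u v

ConnectedOn : ∀ {n} → Graph n → (Fin n → Set) → Set
ConnectedOn G P = ∀ u v → P u → P v → Reach G P u v

Connected : ∀ {n} → Graph n → Set
Connected G = ConnectedOn G (λ _ → ⊤)

T3 : ∀ {n} → Graph n → Subset n → Set
T3 G S = ∣ S ∣ ≡ 3 × ConnectedOn G (λ v → v ∈ S)

SameT3 : ∀ {n} → Graph n → Graph n → Set
SameT3 G H = ∀ S → T3 G S ⇔ T3 H S

Identical : ∀ {n} → Graph n → Graph n → Set
Identical G H = ∀ u v → G u v ≡ H u v

StronglyT3Reconstructible : ∀ {n} → Graph n → Set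
StronglyT3Reconstructible {n} G =
  (H : Graph n) → IsSimple H → Connected H → SameT3 H G → Identical H G

Necessary : ∀ {n} → Graph n → Fin n → Fin n → Set
Necessary {n} G u v =
  ¬ (Σ (Graph n) λ H → IsSimple H × Connected H × (H u v ≡ false) × SameT3 H G)

AllEdgesNecessary : ∀ {n} → Graph n → Set
AllEdgesNecessary G = ∀ u v → Edge G u v → Necessary G u v

addEdge : ∀ {n} → Graph n → Fin n → Fin n → Graph n
addEdge G x y u v =
  G u v ∨ ((does (u ≟ x) ∧ does (v ≟ y)) ∨ (does (u ≟ y) ∧ does (v ≟ x)))

NoEdgeAddable : ∀ {n} → Graph n → Set
NoEdgeAddable G = ∀ x y → x ≢ y → G x y ≡ false → ¬ SameT3 (addEdge G x y) G

DistinctNonAdjNbhds : ∀ {n} → Graph n → Set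
DistinctNonAdjNbhds G =
  ∀ v₁ v₂ → v₁ ≢ v₂ → G v₁ v₂ ≡ false → ¬ (∀ w → G v₁ w ≡ G v₂ w)

-- Two monotonicity facts carry the equivalence: T₃ only grows when edges are
-- added, so if T₃(H) = T₃(G) then every necessary edge of G lies in H, and
-- every edge uv of H missing from G gives T₃(G) ⊆ T₃(G + uv) ⊆ T₃(H) = T₃(G).
-- For the neighbourhood criterion, a connected triple of G + xy through the
-- new edge xy consists of x, y and a vertex w adjacent to x or y. If
-- N(x) = N(y), w is adjacent to both and the triple was already connected in
-- G. If instead w ∈ N(x) ∖ N(y), the triple {x, y, w} is connected in G + xy
-- while y is isolated in it in G.
module Submission where

open import Defs
open import Data.Nat using (ℕ; suc; _+_; _≤_; _<_; z≤n; s≤s)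
open import Data.Nat.Properties
  using (≤-trans; ≤-reflexive; ≤-antisym; <⇒≱; +-suc; +-monoʳ-≤; n≤1+n)
open import Data.Product using (_×_; _,_; ∃; proj₁; proj₂)
open import Data.Sum as Sum using (_⊎_; inj₁; inj₂)
open import Data.Empty using (⊥-elim)
open import Data.Bool using (true; false; _∨_; _∧_)
open import Data.Bool.Properties using (∨-comm; ∧-comm; ∨-zeroʳ)
open import Data.Fin using (Fin; _≟_)
open import Data.Fin.Subset using (Subset; _∈_; _∉_; _⊆_; ∣_∣; _∪_; ⁅_⁆; inside; outside)
open import Data.Fin.Subset.Properties
  using (_∈?_; p⊆q⇒∣p∣≤∣q∣; p⊂q⇒∣p∣<∣q∣; x∈⁅x⁆; x∈⁅y⁆⇒x≡y; ∣⁅x⁆∣≡1; p⊆p∪q; q⊆p∪q; x∈p∪q⁻)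
open import Data.Fin.Properties using (any?)
open import Data.Vec using ([]; _∷_)
open import Function using (_∘_)
open import Function.Bundles using (_⇔_; mk⇔; Equivalence)
open import Relation.Nullary using (¬_; does; yes; no; contradiction)
open import Relation.Nullary.Decidable using (_×-dec_; ¬?; dec-true)
open import Relation.Binary.PropositionalEquality
open ≡-Reasoning

open Equivalence using (to)

private
  variable
    n : ℕ
    G H K : Graph n
    P : Fin n → Set
    S : Subset n
    a b c u v w x y z : Fin n

∣p∪q∣≤∣p∣+∣q∣ : (p q : Subset n) → ∣ p ∪ q ∣ ≤ ∣ p ∣ + ∣ q ∣
∣p∪q∣≤∣p∣+∣q∣ []            []            = z≤n
∣p∪q∣≤∣p∣+∣q∣ (inside ∷ p)  (inside ∷ q)  =
  s≤s (≤-trans (∣p∪q∣≤∣p∣+∣q∣ p q) (+-monoʳ-≤ ∣ p ∣ (n≤1+n ∣ q ∣)))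
∣p∪q∣≤∣p∣+∣q∣ (inside ∷ p)  (outside ∷ q) = s≤s (∣p∪q∣≤∣p∣+∣q∣ p q)
∣p∪q∣≤∣p∣+∣q∣ (outside ∷ p) (inside ∷ q)  =
  ≤-trans (s≤s (∣p∪q∣≤∣p∣+∣q∣ p q)) (≤-reflexive (sym (+-suc ∣ p ∣ ∣ q ∣)))
∣p∪q∣≤∣p∣+∣q∣ (outside ∷ p) (outside ∷ q) = ∣p∪q∣≤∣p∣+∣q∣ p q

x∉p⇒∣⁅x⁆∪p∣≡1+∣p∣ : {p : Subset n} → x ∉ p → ∣ ⁅ x ⁆ ∪ p ∣ ≡ suc ∣ p ∣
x∉p⇒∣⁅x⁆∪p∣≡1+∣p∣ {x = x} {p} x∉p = ≤-antisym
  (≤-trans (∣p∪q∣≤∣p∣+∣q∣ ⁅ x ⁆ p) (≤-reflexive (cong (_+ ∣ p ∣) (∣⁅x⁆∣≡1 x))))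
  (p⊂q⇒∣p∣<∣q∣ (q⊆p∪q ⁅ x ⁆ p , x , p⊆p∪q p (x∈⁅x⁆ x) , x∉p))

∈⁅x⁆∪⁅y⁆⁻ : z ∈ ⁅ x ⁆ ∪ ⁅ y ⁆ → z ≡ x ⊎ z ≡ y
∈⁅x⁆∪⁅y⁆⁻ {x = x} {y = y} = Sum.map (x∈⁅y⁆⇒x≡y x) (x∈⁅y⁆⇒x≡y y) ∘ x∈p∪q⁻ ⁅ x ⁆ ⁅ y ⁆

2<∣p∣⇒∃∈p-≢₂ : {p : Subset n} (x y : Fin n) → 2 < ∣ p ∣ →
               ∃ λ z → z ∈ p × z ≢ x × z ≢ y
2<∣p∣⇒∃∈p-≢₂ {p = p} x y 2<∣p∣
  with any? (λ z → (z ∈? p) ×-dec (¬? (z ≟ x) ×-dec ¬? (z ≟ y)))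
... | yes found = found
... | no none = contradiction (≤-trans (p⊆q⇒∣p∣≤∣q∣ p⊆⁅x⁆∪⁅y⁆) ∣⁅x⁆∪⁅y⁆∣≤2) (<⇒≱ 2<∣p∣)
  where
  p⊆⁅x⁆∪⁅y⁆ : p ⊆ ⁅ x ⁆ ∪ ⁅ y ⁆
  p⊆⁅x⁆∪⁅y⁆ {z} z∈p with z ≟ x | z ≟ y
  ... | yes refl | _        = p⊆p∪q ⁅ y ⁆ (x∈⁅x⁆ z)
  ... | no _     | yes refl = q⊆p∪q ⁅ x ⁆ ⁅ z ⁆ (x∈⁅x⁆ z)
  ... | no z≢x   | no z≢y   = contradiction (z , z∈p , z≢x , z≢y) none
  ∣⁅x⁆∪⁅y⁆∣≤2 : ∣ ⁅ x ⁆ ∪ ⁅ y ⁆ ∣ ≤ 2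
  ∣⁅x⁆∪⁅y⁆∣≤2 = ≤-trans (∣p∪q∣≤∣p∣+∣q∣ ⁅ x ⁆ ⁅ y ⁆)
                        (≤-reflexive (cong₂ _+_ (∣⁅x⁆∣≡1 x) (∣⁅x⁆∣≡1 y)))

triple : Fin n → Fin n → Fin n → Subset n
triple x y w = ⁅ x ⁆ ∪ ⁅ y ⁆ ∪ ⁅ w ⁆

∈-triple⁻ : z ∈ triple x y w → z ≡ x ⊎ z ≡ y ⊎ z ≡ w
∈-triple⁻ {x = x} {y = y} {w = w} =
  Sum.map (x∈⁅y⁆⇒x≡y x) ∈⁅x⁆∪⁅y⁆⁻ ∘ x∈p∪q⁻ ⁅ x ⁆ (⁅ y ⁆ ∪ ⁅ w ⁆)

x∈triple : (x y w : Fin n) → x ∈ triple x y w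
x∈triple x y w = p⊆p∪q (⁅ y ⁆ ∪ ⁅ w ⁆) (x∈⁅x⁆ x)

y∈triple : (x y w : Fin n) → y ∈ triple x y w
y∈triple x y w = q⊆p∪q ⁅ x ⁆ (⁅ y ⁆ ∪ ⁅ w ⁆) (p⊆p∪q ⁅ w ⁆ (x∈⁅x⁆ y))

∣triple∣≡3 : x ≢ y → x ≢ w → y ≢ w → ∣ triple x y w ∣ ≡ 3
∣triple∣≡3 {x = x} {y = y} {w = w} x≢y x≢w y≢w = begin
  ∣ ⁅ x ⁆ ∪ ⁅ y ⁆ ∪ ⁅ w ⁆ ∣ ≡⟨ x∉p⇒∣⁅x⁆∪p∣≡1+∣p∣ (Sum.[ x≢y , x≢w ] ∘ ∈⁅x⁆∪⁅y⁆⁻) ⟩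
  suc ∣ ⁅ y ⁆ ∪ ⁅ w ⁆ ∣     ≡⟨ cong suc (x∉p⇒∣⁅x⁆∪p∣≡1+∣p∣ (y≢w ∘ x∈⁅y⁆⇒x≡y w)) ⟩
  suc (suc ∣ ⁅ w ⁆ ∣)       ≡⟨ cong (suc ∘ suc) (∣⁅x⁆∣≡1 w) ⟩
  3                         ∎

infix 4 _⊆ₑ_

_⊆ₑ_ : Graph n → Graph n → Set
G ⊆ₑ H = ∀ {u v} → Edge G u v → Edge H u v

IsSymmetric : Graph n → Set
IsSymmetric G = ∀ u v → G u v ≡ G v u

Twins : Graph n → Fin n → Fin n → Set
Twins G x y = ∀ w → G x w ≡ G y w

edge-sym : IsSymmetric G → Edge G u v → Edge G v u
edge-sym {u = u} {v = v} sym-G uv = trans (sym-G v u) uv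

edge⇒≢ : (∀ u → G u u ≡ false) → Edge G u v → u ≢ v
edge⇒≢ loopless uu refl = contradiction (trans (sym (loopless _)) uu) λ ()

Reach-mono : G ⊆ₑ H → Reach G P a b → Reach H P a b
Reach-mono G⊆H here             = here
Reach-mono G⊆H (step e Pw walk) = step (G⊆H e) Pw (Reach-mono G⊆H walk)

_◅◅_ : Reach G P a b → Reach G P b c → Reach G P a c
here             ◅◅ walk′ = walk′
step e Pw walk   ◅◅ walk′ = step e Pw (walk ◅◅ walk′)

Reach-expand : (∀ {u v} → P u → P v → Edge H u v → Reach G P u v) →
               P a → Reach H P a b → Reach G P a b
Reach-expand detour Pa here             = here
Reach-expand detour Pa (step e Pw walk) = detour Pa Pw e ◅◅ Reach-expand detour Pw walk

ConnectedOn-mono : G ⊆ₑ H → ConnectedOn G P → ConnectedOn H P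
ConnectedOn-mono G⊆H conn u v Pu Pv = Reach-mono G⊆H (conn u v Pu Pv)

ConnectedOn-expand : (∀ {u v} → P u → P v → Edge H u v → Reach G P u v) →
                     ConnectedOn H P → ConnectedOn G P
ConnectedOn-expand detour conn u v Pu Pv = Reach-expand detour Pu (conn u v Pu Pv)

ConnectedOn-star : {P : Fin n → Set} → IsSymmetric H → P c →
                   (∀ u → P u → u ≡ c ⊎ Edge H c u) → ConnectedOn H P
ConnectedOn-star {H = H} {c = c} {P = P} sym-H Pc spoke u v Pu Pv = toCentre u Pu ◅◅ fromCentre v Pv
  where
  fromCentre : ∀ v → P v → Reach H P c v
  fromCentre v Pv with spoke v Pv
  ... | inj₁ refl = here
  ... | inj₂ cv   = step cv Pv here
  toCentre : ∀ u → P u → Reach H P u c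
  toCentre u Pu with spoke u Pu
  ... | inj₁ refl = here
  ... | inj₂ cu   = step (edge-sym sym-H cu) Pc here

¬Reach-from-isolated : (∀ z → P z → G a z ≡ false) → a ≢ b → ¬ Reach G P a b
¬Reach-from-isolated isolated a≢b here                    = a≢b refl
¬Reach-from-isolated isolated a≢b (step {w = w} e Pw walk) =
  contradiction (trans (sym e) (isolated w Pw)) λ ()

T3-mono : G ⊆ₑ H → T3 G S → T3 H S
T3-mono G⊆H (∣S∣≡3 , conn) = ∣S∣≡3 , ConnectedOn-mono G⊆H conn

SameT3-sandwich : G ⊆ₑ K → K ⊆ₑ H → SameT3 H G → SameT3 K G
SameT3-sandwich G⊆K K⊆H H≈G S = mk⇔ (to (H≈G S) ∘ T3-mono K⊆H) (T3-mono G⊆K)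

G⊆ₑaddEdge : (G : Graph n) (x y : Fin n) → G ⊆ₑ addEdge G x y
G⊆ₑaddEdge G x y uv rewrite uv = refl

addEdge-xy : (G : Graph n) (x y : Fin n) → Edge (addEdge G x y) x y
addEdge-xy G x y rewrite dec-true (x ≟ x) refl | dec-true (y ≟ y) refl = ∨-zeroʳ (G x y)

addEdge-edge⁻ : (G : Graph n) (x y : Fin n) → Edge (addEdge G x y) u v →
                Edge G u v ⊎ (u ≡ x × v ≡ y) ⊎ (u ≡ y × v ≡ x)
addEdge-edge⁻ {u = u} {v = v} G x y e with G u v | u ≟ x | v ≟ y | u ≟ y | v ≟ x | e
... | true  | _        | _        | _        | _        | _ = inj₁ refl
... | false | yes u≡x  | yes v≡y  | _        | _        | _ = inj₂ (inj₁ (u≡x , v≡y))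
... | false | _        | _        | yes u≡y  | yes v≡x  | _ = inj₂ (inj₂ (u≡y , v≡x))
... | false | no _     | _        | no _     | _        | ()
... | false | no _     | _        | yes _    | no _     | ()
... | false | yes _    | no _     | no _     | _        | ()
... | false | yes _    | no _     | yes _    | no _     | ()

addEdge-sym : (x y : Fin n) → IsSymmetric G → IsSymmetric (addEdge G x y)
addEdge-sym x y sym-G u v = cong₂ _∨_ (sym-G u v) (begin
  does (u ≟ x) ∧ does (v ≟ y) ∨ does (u ≟ y) ∧ does (v ≟ x)
    ≡⟨ cong₂ _∨_ (∧-comm (does (u ≟ x)) _) (∧-comm (does (u ≟ y)) _) ⟩
  does (v ≟ y) ∧ does (u ≟ x) ∨ does (v ≟ x) ∧ does (u ≟ y)
    ≡⟨ ∨-comm (does (v ≟ y) ∧ does (u ≟ x)) _ ⟩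
  does (v ≟ x) ∧ does (u ≟ y) ∨ does (v ≟ y) ∧ does (u ≟ x)  ∎)

addEdge-simple : IsSimple G → x ≢ y → IsSimple (addEdge G x y)
addEdge-simple {G = G} {x = x} {y = y} (sym-G , loopless) x≢y = addEdge-sym x y sym-G , loopless′
  where
  loopless′ : ∀ u → addEdge G x y u u ≡ false
  loopless′ u rewrite loopless u with u ≟ x | u ≟ y
  ... | yes refl | yes refl = contradiction refl x≢y
  ... | yes _    | no _     = refl
  ... | no _     | yes _    = refl
  ... | no _     | no _     = refl

addEdge-least : IsSymmetric H → G ⊆ₑ H → Edge H x y → addEdge G x y ⊆ₑ H
addEdge-least {G = G} {x = x} {y = y} sym-H G⊆H xy e with addEdge-edge⁻ G x y e
... | inj₁ uv                    = G⊆H uv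
... | inj₂ (inj₁ (refl , refl))  = xy
... | inj₂ (inj₂ (refl , refl))  = edge-sym sym-H xy

Reach-addEdge-exit : P a → a ≢ x → a ≢ y → Reach (addEdge G x y) P a x →
                     ∃ λ z → P z × (Edge G z x ⊎ Edge G z y)
Reach-addEdge-exit Pa a≢x a≢y here = contradiction refl a≢x
Reach-addEdge-exit {x = x} {y = y} {G = G} Pa a≢x a≢y (step {w = w} e Pw walk)
  with addEdge-edge⁻ G x y e
... | inj₂ (inj₁ (a≡x , _)) = contradiction a≡x a≢x
... | inj₂ (inj₂ (a≡y , _)) = contradiction a≡y a≢y
... | inj₁ aw with w ≟ x | w ≟ y
...   | yes refl | _        = _ , Pa , inj₁ aw
...   | no _     | yes refl = _ , Pa , inj₂ aw
...   | no w≢x   | no w≢y   = Reach-addEdge-exit Pw w≢x w≢y walk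

twins⇒SameT3-addEdge : IsSymmetric G → Twins G x y → SameT3 (addEdge G x y) G
twins⇒SameT3-addEdge {G = G} {x = x} {y = y} sym-G twins S =
  mk⇔ (λ (∣S∣≡3 , conn) → ∣S∣≡3 , ConnectedOn-expand (detour ∣S∣≡3 conn) conn)
      (T3-mono (G⊆ₑaddEdge G x y))
  where
  commonNeighbour : ∣ S ∣ ≡ 3 → ConnectedOn (addEdge G x y) (_∈ S) → x ∈ S →
                    ∃ λ z → z ∈ S × Edge G x z × Edge G y z
  commonNeighbour ∣S∣≡3 conn x∈S with 2<∣p∣⇒∃∈p-≢₂ x y (≤-reflexive (sym ∣S∣≡3))
  ... | w , w∈S , w≢x , w≢y with Reach-addEdge-exit w∈S w≢x w≢y (conn w x w∈S x∈S)
  ...   | z , z∈S , inj₁ zx = z , z∈S , edge-sym sym-G zx , trans (sym (twins z)) (edge-sym sym-G zx)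
  ...   | z , z∈S , inj₂ zy = z , z∈S , trans (twins z) (edge-sym sym-G zy) , edge-sym sym-G zy

  detour : ∣ S ∣ ≡ 3 → ConnectedOn (addEdge G x y) (_∈ S) →
           ∀ {u v} → u ∈ S → v ∈ S → Edge (addEdge G x y) u v → Reach G (_∈ S) u v
  detour ∣S∣≡3 conn u∈S v∈S e with addEdge-edge⁻ G x y e
  ... | inj₁ uv = step uv v∈S here
  ... | inj₂ (inj₁ (refl , refl)) with commonNeighbour ∣S∣≡3 conn u∈S
  ...   | z , z∈S , xz , yz = step xz z∈S (step (edge-sym sym-G yz) v∈S here)
  detour ∣S∣≡3 conn u∈S v∈S e | inj₂ (inj₂ (refl , refl)) with commonNeighbour ∣S∣≡3 conn v∈S
  ...   | z , z∈S , xz , yz = step yz z∈S (step (edge-sym sym-G xz) v∈S here)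

addEdge-breaks-T3 : IsSimple G → x ≢ y → G x y ≡ false → Edge G x w → G y w ≡ false →
                    ¬ SameT3 (addEdge G x y) G
addEdge-breaks-T3 {G = G} {x = x} {y = y} {w = w} (sym-G , loopless) x≢y xy∉ xw yw∉ same =
  ¬Reach-from-isolated y-isolated (x≢y ∘ sym) (tripleConnected y x (y∈triple x y w) (x∈triple x y w))
  where
  x≢w : x ≢ w
  x≢w = edge⇒≢ loopless xw
  y≢w : y ≢ w
  y≢w refl = contradiction (trans (sym xy∉) xw) λ ()

  spoke : ∀ u → u ∈ triple x y w → u ≡ x ⊎ Edge (addEdge G x y) x u
  spoke u u∈S with ∈-triple⁻ u∈S
  ... | inj₁ u≡x         = inj₁ u≡x
  ... | inj₂ (inj₁ refl) = inj₂ (addEdge-xy G x y)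
  ... | inj₂ (inj₂ refl) = inj₂ (G⊆ₑaddEdge G x y xw)

  tripleConnected : ConnectedOn G (_∈ triple x y w)
  tripleConnected = proj₂ (to (same (triple x y w))
    (∣triple∣≡3 x≢y x≢w y≢w , ConnectedOn-star (addEdge-sym x y sym-G) (x∈triple x y w) spoke))

  y-isolated : ∀ z → z ∈ triple x y w → G y z ≡ false
  y-isolated z z∈S with ∈-triple⁻ z∈S
  ... | inj₁ refl         = trans (sym-G y x) xy∉
  ... | inj₂ (inj₁ refl)  = loopless y
  ... | inj₂ (inj₂ refl)  = yw∉

SameT3-addEdge⇒twins : IsSimple G → x ≢ y → G x y ≡ false →
                       SameT3 (addEdge G x y) G → Twins G x y
SameT3-addEdge⇒twins {G = G} {x = x} {y = y} simple@(sym-G , _) x≢y xy∉ same w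
  with G x w in xw | G y w in yw
... | true  | true  = refl
... | false | false = refl
... | true  | false = ⊥-elim (addEdge-breaks-T3 simple x≢y xy∉ xw yw same)
... | false | true  =
  ⊥-elim (addEdge-breaks-T3 simple (x≢y ∘ sym) (trans (sym-G y x) xy∉) yw xw same′)
  where
  same′ : SameT3 (addEdge G y x) G
  same′ = SameT3-sandwich (G⊆ₑaddEdge G y x)
    (addEdge-least (addEdge-sym x y sym-G) (G⊆ₑaddEdge G x y)
                   (edge-sym (addEdge-sym x y sym-G) (addEdge-xy G x y)))
    same

reconstructible⇒allEdgesNecessary : StronglyT3Reconstructible G → AllEdgesNecessary G
reconstructible⇒allEdgesNecessary {G = G} rec u v uv (H , simple , conn , uv∉H , same) =
  contradiction (begin
    false  ≡⟨ sym uv∉H ⟩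
    H u v  ≡⟨ rec H simple conn same u v ⟩
    G u v  ≡⟨ uv ⟩
    true   ∎) λ ()

reconstructible⇒noEdgeAddable : IsSimple G → Connected G →
                                StronglyT3Reconstructible G → NoEdgeAddable G
reconstructible⇒noEdgeAddable {G = G} simple conn rec x y x≢y xy∉ same =
  contradiction (begin
    false              ≡⟨ sym xy∉ ⟩
    G x y              ≡⟨ sym (rec (addEdge G x y) (addEdge-simple simple x≢y)
                                   (ConnectedOn-mono (G⊆ₑaddEdge G x y) conn) same x y) ⟩
    addEdge G x y x y  ≡⟨ addEdge-xy G x y ⟩
    true               ∎) λ ()

allEdgesNecessary⇒⊆ₑ : AllEdgesNecessary G → IsSimple H → Connected H → SameT3 H G → G ⊆ₑ H
allEdgesNecessary⇒⊆ₑ {H = H} necessary simple conn same {u} {v} uv with H u v in uv∈H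
... | true  = refl
... | false = ⊥-elim (necessary u v uv (H , simple , conn , uv∈H , same))

necessary×noneAddable⇒reconstructible : AllEdgesNecessary G → NoEdgeAddable G →
                                        StronglyT3Reconstructible G
necessary×noneAddable⇒reconstructible {G = G} necessary noneAddable
  H simple@(sym-H , loopless) conn same u v with G u v in uv∈G | H u v in uv∈H
... | true  | true  = refl
... | false | false = refl
... | true  | false = ⊥-elim (necessary u v uv∈G (H , simple , conn , uv∈H , same))
... | false | true  = ⊥-elim (noneAddable u v (edge⇒≢ loopless uv∈H) uv∈G
        (SameT3-sandwich (G⊆ₑaddEdge G u v) (addEdge-least sym-H G⊆H uv∈H) same))
  where
  G⊆H : G ⊆ₑ H
  G⊆H = allEdgesNecessary⇒⊆ₑ necessary simple conn same

lemma4p7 : (n : ℕ) (G : Graph n) → IsSimple G → Connected G →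
    (StronglyT3Reconstructible G ⇔ (AllEdgesNecessary G × NoEdgeAddable G))
    × (NoEdgeAddable G ⇔ DistinctNonAdjNbhds G)
lemma4p7 n G simple conn =
  mk⇔ (λ rec → reconstructible⇒allEdgesNecessary rec , reconstructible⇒noEdgeAddable simple conn rec)
      (λ (necessary , noneAddable) → necessary×noneAddable⇒reconstructible necessary noneAddable)
  , mk⇔ (λ noneAddable x y x≢y xy∉ twins →
           noneAddable x y x≢y xy∉ (twins⇒SameT3-addEdge (proj₁ simple) twins))
        (λ distinct x y x≢y xy∉ same →
           distinct x y x≢y xy∉ (SameT3-addEdge⇒twins simple x≢y xy∉ same))
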